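{- Let $t$ be the Thue–Morse word, the fixed point starting with $a$ of the morphism $a\mapsto abba$, $b\mapsto baab$. Then \[\limsup_{n\to\infty}\frac{PPL_t(n)}{\ln n}=\frac{3}{4\ln 2},\qquad \liminf_{n\to\infty}\frac{PPL_t(n)}{\ln n}=0.\]
   Context: $PPL_t(n)$ is the minimal number of palindromes whose concatenation is the prefix of $t$ of length $n$. -}

module Defs where

open import Data.Nat using (ℕ; _+_; _*_)
open import Data.Fin using (Fin; toℕ; zero; suc)
open import Data.List using (List; []; _∷_; reverse; concat; length; map; upTo)
open import Data.List.Relation.Unary.All using (All)
open import Data.Product using (Σ; _×_; ∃)
open import Data.Nat using (_≤_)
open import Relation.Binary.PropositionalEquality using (_≡_)

data Letter : Set where
  a b : Letter

-- The morphism φ : a ↦ abba, b ↦ baab, given letter-by-letter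
-- (φ x j is the j-th letter of φ(x), j ∈ {0,1,2,3}).
φ : Letter → Fin 4 → Letter
φ a zero                   = a
φ a (suc zero)             = b
φ a (suc (suc zero))       = b
φ a (suc (suc (suc zero))) = a
φ b zero                   = b
φ b (suc zero)             = a
φ b (suc (suc zero))       = a
φ b (suc (suc (suc zero))) = b

-- An infinite word t (indexed from 0) is a fixed point of φ,
-- i.e. φ(t) = t: the block of positions 4i..4i+3 of t is φ(t i).
IsFixedPointφ : (ℕ → Letter) → Set
IsFixedPointφ t = (i : ℕ) (j : Fin 4) → t (4 * i + toℕ j) ≡ φ (t i) j

prefix : (ℕ → Letter) → ℕ → List Letter
prefix t n = map t (upTo n)

Palindrome : List Letter → Set
Palindrome w = reverse w ≡ w

PalFactorization : List Letter → ℕ → Set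
PalFactorization w k =
  Σ (List (List Letter)) λ ws → All Palindrome ws × concat ws ≡ w × length ws ≡ k

IsPalLength : List Letter → ℕ → Set
IsPalLength w k = PalFactorization w k × (∀ m → PalFactorization w m → k ≤ m)

{-# OPTIONS --safe #-}
-- PPL_t(n) equals an explicit function ppl n, computed along the base-4 digits of n by
--   ppl (4n) = ppl n,  ppl (4n+1) = ppl n + 1,  ppl (4n+3) = ppl (n+1) + 1,
--   ppl (4n+2) = 2 + min (ppl n, ppl (n+1)).
-- Factorizations with at most ppl n blocks come from shorter ones by applying φ, which maps
-- palindromes to palindromes.  Conversely t has no palindromes of odd length ≥ 5 and none of
-- even length centred at an even position, so every palindrome of t desubstitutes to a shorter
-- one; by induction, appending a palindrome raises ppl by at most one, and no factorization
-- beats ppl n.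
-- The asymptotics are read off the recursion: ppl n + ppl (n+1) grows by at most 3 per digit,
-- whence 2^(4 ppl n) ≤ 1024 n³; the digits 1, 2 appended alternately raise ppl by 3 per two
-- digits, which attains this bound; and ppl (4^k) = 1.
module Submission where

open import Defs
open import Data.Empty using (⊥-elim)
open import Data.Fin using (Fin; toℕ; opposite)
open import Data.Fin.Patterns using (0F; 1F; 2F; 3F)
open import Data.Fin.Properties using (toℕ-injective; toℕ<n; opposite-prop)
open import Data.List
  using (List; []; _∷_; _++_; [_]; foldr; reverse; concat; length; applyUpTo; applyDownFrom)
open import Data.List.Properties
  using (∷-injectiveˡ; ∷-injectiveʳ; reverse-applyUpTo; map-upTo; concat-++; ++-identityʳ; length-++)
open import Data.List.Relation.Unary.All using (All; []; _∷_)
open import Data.List.Relation.Unary.All.Properties using (++⁺)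
open import Data.Nat
open import Data.Nat.Induction using (<-Rec; <-rec)
open import Data.Nat.Properties
open import Data.Nat.Tactic.RingSolver using (solve-∀)
open import Data.Product using (Σ; ∃; ∃₂; _×_; _,_; proj₁; proj₂; uncurry)
open import Data.Sum using (_⊎_; inj₁; inj₂)
open import Function using (_∘_)
open import Relation.Binary.PropositionalEquality hiding ([_])
open import Relation.Nullary using (¬_)
open import Relation.Nullary.Decidable using (from-yes)

data Mod4 : ℕ → Set where
  4q+0 : ∀ q → Mod4 (4 * q)
  4q+1 : ∀ q → Mod4 (4 * q + 1)
  4q+2 : ∀ q → Mod4 (4 * q + 2)
  4q+3 : ∀ q → Mod4 (4 * q + 3)

mod4 : ∀ n → Mod4 n
mod4 zero = 4q+0 0
mod4 (suc n) with mod4 n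
... | 4q+0 q = subst Mod4 (+-comm (4 * q) 1) (4q+1 q)
... | 4q+1 q = subst Mod4 (+-suc (4 * q) 1) (4q+2 q)
... | 4q+2 q = subst Mod4 (+-suc (4 * q) 2) (4q+3 q)
... | 4q+3 q = subst Mod4 (4*suc q) (4q+0 (suc q))
  where
  4*suc : ∀ q → 4 * suc q ≡ suc (4 * q + 3)
  4*suc = solve-∀

divMod4 : ∀ n → ∃₂ λ q (r : Fin 4) → 4 * q + toℕ r ≡ n
divMod4 n with mod4 n
... | 4q+0 q = q , 0F , +-identityʳ (4 * q)
... | 4q+1 q = q , 1F , refl
... | 4q+2 q = q , 2F , refl
... | 4q+3 q = q , 3F , refl

even⊎odd : ∀ n → ∃ λ k → n ≡ k + k ⊎ n ≡ suc (k + k)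
even⊎odd zero = 0 , inj₁ refl
even⊎odd (suc n) with even⊎odd n
... | k , inj₁ n≡2k   = k , inj₂ (cong suc n≡2k)
... | k , inj₂ n≡2k+1 = suc k , inj₁ (trans (cong suc n≡2k+1) (cong suc (sym (+-suc k k))))

4*m+c≡4*n : ∀ m n c → 0 < c → c < 8 → 4 * m + c ≡ 4 * n → c ≡ 4 × suc m ≡ n
4*m+c≡4*n m n c 0<c c<8 eq = c≡4 , 1+m≡n
  where
  m<n : m < n
  m<n = *-cancelˡ-< 4 m n (subst (4 * m <_) eq (m<m+n (4 * m) 0<c))
  n<2+m : n < 2 + m
  n<2+m = *-cancelˡ-< 4 n (2 + m)
    (subst₂ _<_ eq (trans (+-comm (4 * m) 8) (sym (*-distribˡ-+ 4 2 m))) (+-monoʳ-< (4 * m) c<8))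
  1+m≡n : suc m ≡ n
  1+m≡n = ≤-antisym m<n (s≤s⁻¹ n<2+m)
  c≡4 : c ≡ 4
  c≡4 = +-cancelˡ-≡ (4 * m) c 4
    (trans eq (trans (cong (4 *_) (sym 1+m≡n)) (trans (*-suc 4 m) (+-comm 4 (4 * m)))))

m+1+k≡n⇒m<n : ∀ m k {n} → m + suc k ≡ n → m < n
m+1+k≡n⇒m<n m k eq = subst (m <_) eq (m<m+n m z<s)

^-distribʳ-* : ∀ m n k → (m * n) ^ k ≡ m ^ k * n ^ k
^-distribʳ-* m n zero    = refl
^-distribʳ-* m n (suc k) = trans (cong (m * n *_) (^-distribʳ-* m n k)) (interchange m n (m ^ k) (n ^ k))
  where
  interchange : ∀ a b c d → a * b * (c * d) ≡ a * c * (b * d)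
  interchange = solve-∀

^-cancelˡ-< : ∀ k {m n} → m ^ k < n ^ k → m < n
^-cancelˡ-< k {m} {n} mᵏ<nᵏ = ≰⇒> λ n≤m → <-irrefl refl (<-≤-trans mᵏ<nᵏ (^-monoˡ-≤ k n≤m))

n≤4^n : ∀ n → n ≤ 4 ^ n
n≤4^n zero    = z≤n
n≤4^n (suc n) = +-mono-≤ (m^n>0 4 n) (≤-trans (n≤4^n n) (m≤m+n (4 ^ n) _))

module _ {A : Set} where

  applyUpTo-+ : ∀ (f : ℕ → A) m n → applyUpTo f (m + n) ≡ applyUpTo f m ++ applyUpTo (λ i → f (m + i)) n
  applyUpTo-+ f zero    n = refl
  applyUpTo-+ f (suc m) n = cong (f 0 ∷_) (applyUpTo-+ (f ∘ suc) m n)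

  applyUpTo-cong : ∀ {f g : ℕ → A} n → (∀ i → i < n → f i ≡ g i) → applyUpTo f n ≡ applyUpTo g n
  applyUpTo-cong zero    f≡g = refl
  applyUpTo-cong (suc n) f≡g = cong₂ _∷_ (f≡g 0 z<s) (applyUpTo-cong n (λ i i<n → f≡g (suc i) (s<s i<n)))

  applyUpTo-injective : ∀ {f g : ℕ → A} n → applyUpTo f n ≡ applyUpTo g n → ∀ i → i < n → f i ≡ g i
  applyUpTo-injective (suc n) eq zero    _         = ∷-injectiveˡ eq
  applyUpTo-injective (suc n) eq (suc i) (s<s i<n) = applyUpTo-injective n (∷-injectiveʳ eq) i i<n

  applyDownFrom-applyUpTo : ∀ (f : ℕ → A) n → applyDownFrom f n ≡ applyUpTo (λ i → f (n ∸ suc i)) n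
  applyDownFrom-applyUpTo f zero    = refl
  applyDownFrom-applyUpTo f (suc n) = cong (f n ∷_) (applyDownFrom-applyUpTo f n)

  reverse-applyUpTo′ : ∀ (f : ℕ → A) n → reverse (applyUpTo f n) ≡ applyUpTo (λ i → f (n ∸ suc i)) n
  reverse-applyUpTo′ f n = trans (reverse-applyUpTo f n) (applyDownFrom-applyUpTo f n)

  ++-≡-applyUpTo : ∀ (f : ℕ → A) xs ys n → xs ++ ys ≡ applyUpTo f n →
    ∃₂ λ m k → m + k ≡ n × xs ≡ applyUpTo f m × ys ≡ applyUpTo (λ i → f (m + i)) k
  ++-≡-applyUpTo f []       ys n       eq = 0 , n , refl , refl , eq
  ++-≡-applyUpTo f (x ∷ xs) ys (suc n) eq with ++-≡-applyUpTo (f ∘ suc) xs ys n (∷-injectiveʳ eq)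
  ... | m , k , m+k≡n , xs≡ , ys≡ = suc m , k , cong suc m+k≡n , cong₂ _∷_ (∷-injectiveˡ eq) xs≡ , ys≡

-- The function ppl

-- Base-4 digit lists, least significant digit first.
incr : List (Fin 4) → List (Fin 4)
incr []        = 1F ∷ []
incr (0F ∷ ds) = 1F ∷ ds
incr (1F ∷ ds) = 2F ∷ ds
incr (2F ∷ ds) = 3F ∷ ds
incr (3F ∷ ds) = 0F ∷ incr ds

digits : ℕ → List (Fin 4)
digits zero    = []
digits (suc n) = incr (digits n)

-- step r (ppl n , ppl (n + 1)) = (ppl (4n + r) , ppl (4n + r + 1)).
step : Fin 4 → ℕ × ℕ → ℕ × ℕ
step 0F (x , y) = x , suc x
step 1F (x , y) = suc x , 2 + x ⊓ y
step 2F (x , y) = 2 + x ⊓ y , suc y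
step 3F (x , y) = suc y , y

pplPair : ℕ → ℕ × ℕ
pplPair n = foldr step (0 , 1) (digits n)

ppl : ℕ → ℕ
ppl n = proj₁ (pplPair n)

ppl-suc : ∀ n → ppl (suc n) ≡ proj₂ (pplPair n)
ppl-suc n = proj₁-incr (digits n)
  where
  proj₁-incr : ∀ ds → proj₁ (foldr step (0 , 1) (incr ds)) ≡ proj₂ (foldr step (0 , 1) ds)
  proj₁-incr []        = refl
  proj₁-incr (0F ∷ ds) = refl
  proj₁-incr (1F ∷ ds) = refl
  proj₁-incr (2F ∷ ds) = refl
  proj₁-incr (3F ∷ ds) = proj₁-incr ds

digits-4*suc : ∀ x → digits (4 * suc x) ≡ 0F ∷ digits (suc x)
digits-4*suc zero    = refl
digits-4*suc (suc x) = begin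
  digits (4 * suc (suc x))                         ≡⟨ cong digits (*-suc 4 (suc x)) ⟩
  incr (incr (incr (incr (digits (4 * suc x)))))   ≡⟨ cong (λ ds → incr (incr (incr (incr ds)))) (digits-4*suc x) ⟩
  0F ∷ digits (suc (suc x))                        ∎
  where open ≡-Reasoning

pplPair-digit : ∀ x (r : Fin 4) → pplPair (4 * x + toℕ r) ≡ step r (pplPair x)
pplPair-digit zero 0F = refl
pplPair-digit zero 1F = refl
pplPair-digit zero 2F = refl
pplPair-digit zero 3F = refl
pplPair-digit (suc x) r =
  cong (foldr step (0 , 1)) (trans (cong digits (+-comm (4 * suc x) (toℕ r))) (digits-r+4*suc r))
  where
  digits-r+4*suc : ∀ r → digits (toℕ r + 4 * suc x) ≡ r ∷ digits (suc x)
  digits-r+4*suc 0F = digits-4*suc x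
  digits-r+4*suc 1F = cong incr (digits-4*suc x)
  digits-r+4*suc 2F = cong (λ ds → incr (incr ds)) (digits-4*suc x)
  digits-r+4*suc 3F = cong (λ ds → incr (incr (incr ds))) (digits-4*suc x)

ppl-4n : ∀ n → ppl (4 * n) ≡ ppl n
ppl-4n n = trans (cong ppl (sym (+-identityʳ (4 * n)))) (cong proj₁ (pplPair-digit n 0F))

ppl-4n+1 : ∀ n → ppl (4 * n + 1) ≡ suc (ppl n)
ppl-4n+1 n = cong proj₁ (pplPair-digit n 1F)

ppl-4n+2 : ∀ n → ppl (4 * n + 2) ≡ 2 + ppl n ⊓ ppl (suc n)
ppl-4n+2 n rewrite ppl-suc n = cong proj₁ (pplPair-digit n 2F)

ppl-4n+3 : ∀ n → ppl (4 * n + 3) ≡ suc (ppl (suc n))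
ppl-4n+3 n rewrite ppl-suc n = cong proj₁ (pplPair-digit n 3F)

AtMostOneApart : ℕ × ℕ → Set
AtMostOneApart (x , y) = x ≤ suc y × y ≤ suc x

step-atMostOneApart : ∀ r {p} → AtMostOneApart p → AtMostOneApart (step r p)
step-atMostOneApart 0F {x , y} _ = m≤n+m x 2 , ≤-refl
step-atMostOneApart 1F {x , y} (x≤1+y , _) =
  s≤s (≤-trans (⊓-glb (n≤1+n x) x≤1+y) (n≤1+n _)) , s≤s (s≤s (m⊓n≤m x y))
step-atMostOneApart 2F {x , y} (_ , y≤1+x) =
  s≤s (s≤s (m⊓n≤n x y)) , s≤s (≤-trans (⊓-glb y≤1+x (n≤1+n y)) (n≤1+n _))
step-atMostOneApart 3F {x , y} _ = ≤-refl , m≤n+m y 2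

pplPair-atMostOneApart : ∀ n → AtMostOneApart (pplPair n)
pplPair-atMostOneApart n = fold (digits n)
  where
  fold : ∀ ds → AtMostOneApart (foldr step (0 , 1) ds)
  fold []       = z≤n , s≤s z≤n
  fold (r ∷ ds) = step-atMostOneApart r (fold ds)

ppl-suc-≤ : ∀ n → ppl (suc n) ≤ suc (ppl n)
ppl-suc-≤ n rewrite ppl-suc n = proj₂ (pplPair-atMostOneApart n)

ppl-≤-suc : ∀ n → ppl n ≤ suc (ppl (suc n))
ppl-≤-suc n rewrite ppl-suc n = proj₁ (pplPair-atMostOneApart n)

-- Fixed points of φ and their palindromes

complement : Letter → Letter
complement a = b
complement b = a

x≢complement-x : ∀ x → x ≢ complement x
x≢complement-x a ()
x≢complement-x b ()

φ-palindrome : ∀ x (r : Fin 4) → φ x (opposite r) ≡ φ x r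
φ-palindrome a 0F = refl
φ-palindrome a 1F = refl
φ-palindrome a 2F = refl
φ-palindrome a 3F = refl
φ-palindrome b 0F = refl
φ-palindrome b 1F = refl
φ-palindrome b 2F = refl
φ-palindrome b 3F = refl

φ-mirror : ∀ x (r s : Fin 4) → toℕ r + toℕ s ≡ 3 → φ x r ≡ φ x s
φ-mirror x r s r+s≡3 = trans (sym (φ-palindrome x r)) (cong (φ x) (sym s≡opposite-r))
  where
  s≡opposite-r : s ≡ opposite r
  s≡opposite-r = toℕ-injective (begin
    toℕ s                   ≡⟨ sym (m+n∸m≡n (toℕ r) (toℕ s)) ⟩
    toℕ r + toℕ s ∸ toℕ r   ≡⟨ cong (_∸ toℕ r) r+s≡3 ⟩
    3 ∸ toℕ r               ≡⟨ sym (opposite-prop r) ⟩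
    toℕ (opposite r)        ∎)
    where open ≡-Reasoning

module FixedPointOfφ (t : ℕ → Letter) (fp : IsFixedPointφ t) where

  t-4n : ∀ n → t (4 * n) ≡ t n
  t-4n n = trans (cong t (sym (+-identityʳ (4 * n)))) (trans (fp n 0F) (φ-0F (t n)))
    where
    φ-0F : ∀ x → φ x 0F ≡ x
    φ-0F a = refl
    φ-0F b = refl

  t-4n+1 : ∀ n → t (4 * n + 1) ≡ complement (t n)
  t-4n+1 n = trans (fp n 1F) (φ-1F (t n))
    where
    φ-1F : ∀ x → φ x 1F ≡ complement x
    φ-1F a = refl
    φ-1F b = refl

  t-4n+2 : ∀ n → t (4 * n + 2) ≡ complement (t n)
  t-4n+2 n = trans (fp n 2F) (φ-2F (t n))
    where
    φ-2F : ∀ x → φ x 2F ≡ complement x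
    φ-2F a = refl
    φ-2F b = refl

  t-4n+3 : ∀ n → t (4 * n + 3) ≡ t n
  t-4n+3 n = trans (fp n 3F) (φ-3F (t n))
    where
    φ-3F : ∀ x → φ x 3F ≡ x
    φ-3F a = refl
    φ-3F b = refl

  t-2n≢t-2n+1 : ∀ n → t (n + n) ≢ t (suc (n + n))
  t-2n≢t-2n+1 n eq with even⊎odd n
  ... | k , inj₁ refl = x≢complement-x (t k) (begin
    t k                       ≡⟨ sym (t-4n k) ⟩
    t (4 * k)                 ≡⟨ cong t (4k≡2k+2k k) ⟩
    t (k + k + (k + k))       ≡⟨ eq ⟩
    t (suc (k + k + (k + k))) ≡⟨ cong t (+-comm 1 (k + k + (k + k))) ⟩
    t (k + k + (k + k) + 1)   ≡⟨ cong (λ m → t (m + 1)) (sym (4k≡2k+2k k)) ⟩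
    t (4 * k + 1)             ≡⟨ t-4n+1 k ⟩
    complement (t k)          ∎)
    where
    open ≡-Reasoning
    4k≡2k+2k : ∀ k → 4 * k ≡ k + k + (k + k)
    4k≡2k+2k = solve-∀
  ... | k , inj₂ refl = x≢complement-x (t k) (begin
    t k                                   ≡⟨ sym (t-4n+3 k) ⟩
    t (4 * k + 3)                         ≡⟨ cong t (4k+3≡1+2k+1+2k+1 k) ⟩
    t (suc (suc (k + k) + suc (k + k)))   ≡⟨ sym eq ⟩
    t (suc (k + k) + suc (k + k))         ≡⟨ cong t (sym (4k+2≡2k+1+2k+1 k)) ⟩
    t (4 * k + 2)                         ≡⟨ t-4n+2 k ⟩
    complement (t k)                      ∎)
    where
    open ≡-Reasoning
    4k+2≡2k+1+2k+1 : ∀ k → 4 * k + 2 ≡ suc (k + k) + suc (k + k)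
    4k+2≡2k+1+2k+1 = solve-∀
    4k+3≡1+2k+1+2k+1 : ∀ k → 4 * k + 3 ≡ suc (suc (k + k) + suc (k + k))
    4k+3≡1+2k+1+2k+1 = solve-∀

  PalindromeAt : ℕ → ℕ → Set
  PalindromeAt M L = ∀ i j → suc (i + j) ≡ L → t (M + i) ≡ t (M + j)

  palindromeAt-mirror : ∀ {M L u v} → PalindromeAt M L →
    ∀ i j → suc (i + j) ≡ L → M + i ≡ u → M + j ≡ v → t u ≡ t v
  palindromeAt-mirror pal i j i+j+1≡L refl refl = pal i j i+j+1≡L

  palindromeAt-1 : ∀ M → PalindromeAt M 1
  palindromeAt-1 M zero zero refl = refl

  palindromeAt-inner : ∀ {M} d L → PalindromeAt M (d + L + d) → PalindromeAt (M + d) L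
  palindromeAt-inner {M} d L pal i j i+j+1≡L =
    palindromeAt-mirror pal (d + i) (d + j)
      (trans (shift d i j) (cong (λ L → d + L + d) i+j+1≡L)) (sym (+-assoc M d i)) (sym (+-assoc M d j))
    where
    shift : ∀ d i j → suc (d + i + (d + j)) ≡ d + suc (i + j) + d
    shift = solve-∀

  palindromeAt-shrink : ∀ {M L} → PalindromeAt M (2 + L) → PalindromeAt (suc M) L
  palindromeAt-shrink {M} {L} pal =
    subst (λ M → PalindromeAt M L) (+-comm M 1)
      (palindromeAt-inner 1 L (subst (PalindromeAt M) (cong suc (+-comm 1 L)) pal))

  palindromeAt-fromPositive : ∀ {M L} →
    (∀ i j → suc (i + suc j) ≡ L → t (M + i) ≡ t (M + suc j)) → PalindromeAt M L
  palindromeAt-fromPositive mirror i       (suc j) eq = mirror i j eq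
  palindromeAt-fromPositive mirror zero    zero    eq = refl
  palindromeAt-fromPositive mirror (suc i) zero    eq =
    sym (mirror 0 i (trans (cong (2 +_) (sym (+-identityʳ i))) eq))

  ¬palindromeAt-5 : ∀ M → ¬ PalindromeAt M 5
  ¬palindromeAt-5 M pal with mod4 M
  ... | 4q+0 k = x≢complement-x (t k) (begin
    t k                 ≡⟨ sym (t-4n+3 k) ⟩
    t (4 * k + 3)       ≡⟨ sym (pal 1 3 refl) ⟩
    t (4 * k + 1)       ≡⟨ t-4n+1 k ⟩
    complement (t k)    ∎)
    where open ≡-Reasoning
  ... | 4q+1 k = x≢complement-x (t (suc k)) (begin
    t (suc k)                ≡⟨ sym (t-4n (suc k)) ⟩
    t (4 * suc k)            ≡⟨ palindromeAt-mirror pal 3 1 refl (4k+1+3≡4k+4 k) (4k+1+1≡4k+2 k) ⟩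
    t (4 * k + 2)            ≡⟨ t-4n+2 k ⟩
    complement (t k)         ≡⟨ sym (t-4n+1 k) ⟩
    t (4 * k + 1)            ≡⟨ palindromeAt-mirror pal 0 4 refl (+-identityʳ (4 * k + 1)) (4k+1+4≡4k+5 k) ⟩
    t (4 * suc k + 1)        ≡⟨ t-4n+1 (suc k) ⟩
    complement (t (suc k))   ∎)
    where
    open ≡-Reasoning
    4k+1+1≡4k+2 : ∀ k → 4 * k + 1 + 1 ≡ 4 * k + 2
    4k+1+1≡4k+2 = solve-∀
    4k+1+3≡4k+4 : ∀ k → 4 * k + 1 + 3 ≡ 4 * suc k
    4k+1+3≡4k+4 = solve-∀
    4k+1+4≡4k+5 : ∀ k → 4 * k + 1 + 4 ≡ 4 * suc k + 1
    4k+1+4≡4k+5 = solve-∀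
  ... | 4q+2 k = x≢complement-x (t k) (begin
    t k                      ≡⟨ sym (t-4n+3 k) ⟩
    t (4 * k + 3)            ≡⟨ palindromeAt-mirror pal 1 3 refl (4k+2+1≡4k+3 k) (4k+2+3≡4k+5 k) ⟩
    t (4 * suc k + 1)        ≡⟨ t-4n+1 (suc k) ⟩
    complement (t (suc k))   ≡⟨ sym (t-4n+2 (suc k)) ⟩
    t (4 * suc k + 2)        ≡⟨ palindromeAt-mirror pal 4 0 refl (4k+2+4≡4k+6 k) (+-identityʳ (4 * k + 2)) ⟩
    t (4 * k + 2)            ≡⟨ t-4n+2 k ⟩
    complement (t k)         ∎)
    where
    open ≡-Reasoning
    4k+2+1≡4k+3 : ∀ k → 4 * k + 2 + 1 ≡ 4 * k + 3
    4k+2+1≡4k+3 = solve-∀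
    4k+2+3≡4k+5 : ∀ k → 4 * k + 2 + 3 ≡ 4 * suc k + 1
    4k+2+3≡4k+5 = solve-∀
    4k+2+4≡4k+6 : ∀ k → 4 * k + 2 + 4 ≡ 4 * suc k + 2
    4k+2+4≡4k+6 = solve-∀
  ... | 4q+3 k = x≢complement-x (t (suc k)) (begin
    t (suc k)                ≡⟨ sym (t-4n (suc k)) ⟩
    t (4 * suc k)            ≡⟨ palindromeAt-mirror pal 1 3 refl (4k+3+1≡4k+4 k) (4k+3+3≡4k+6 k) ⟩
    t (4 * suc k + 2)        ≡⟨ t-4n+2 (suc k) ⟩
    complement (t (suc k))   ∎)
    where
    open ≡-Reasoning
    4k+3+1≡4k+4 : ∀ k → 4 * k + 3 + 1 ≡ 4 * suc k
    4k+3+1≡4k+4 = solve-∀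
    4k+3+3≡4k+6 : ∀ k → 4 * k + 3 + 3 ≡ 4 * suc k + 2
    4k+3+3≡4k+6 = solve-∀

  ¬palindromeAt-odd≥5 : ∀ {M L} c → c + 5 + c ≡ L → ¬ PalindromeAt M L
  ¬palindromeAt-odd≥5 {M} c refl pal = ¬palindromeAt-5 (M + c) (palindromeAt-inner c 5 pal)

  ¬palindromeAt-evenCentre : ∀ {M L} c n → suc c + suc c ≡ L → M + c ≡ n + n → ¬ PalindromeAt M L
  ¬palindromeAt-evenCentre {M} c n refl M+c≡2n pal =
    t-2n≢t-2n+1 n (palindromeAt-mirror pal c (suc c) refl M+c≡2n (trans (+-suc M c) (cong suc M+c≡2n)))

  palindromeAt-φ : ∀ {m l} → PalindromeAt m l → PalindromeAt (4 * m) (4 * l)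
  palindromeAt-φ {m} {l} pal i j i+j+1≡4l with divMod4 i | divMod4 j
  ... | qi , ri , refl | qj , rj , refl = begin
    t (4 * m + (4 * qi + toℕ ri))   ≡⟨ cong t (regroup m qi (toℕ ri)) ⟩
    t (4 * (m + qi) + toℕ ri)       ≡⟨ fp (m + qi) ri ⟩
    φ (t (m + qi)) ri               ≡⟨ cong (λ x → φ x ri) (pal qi qj 1+qi+qj≡l) ⟩
    φ (t (m + qj)) ri               ≡⟨ φ-mirror (t (m + qj)) ri rj ri+rj≡3 ⟩
    φ (t (m + qj)) rj               ≡⟨ sym (fp (m + qj) rj) ⟩
    t (4 * (m + qj) + toℕ rj)       ≡⟨ cong t (sym (regroup m qj (toℕ rj))) ⟩
    t (4 * m + (4 * qj + toℕ rj))   ∎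
    where
    open ≡-Reasoning
    regroup : ∀ m q r → 4 * m + (4 * q + r) ≡ 4 * (m + q) + r
    regroup = solve-∀
    carry : ∀ qi qj ri rj → suc (4 * qi + ri + (4 * qj + rj)) ≡ 4 * (qi + qj) + suc (ri + rj)
    carry = solve-∀
    quotients : suc (toℕ ri + toℕ rj) ≡ 4 × suc (qi + qj) ≡ l
    quotients = 4*m+c≡4*n (qi + qj) l (suc (toℕ ri + toℕ rj)) z<s
      (s≤s (s≤s (+-mono-≤ (s≤s⁻¹ (toℕ<n ri)) (s≤s⁻¹ (toℕ<n rj)))))
      (trans (sym (carry qi qj (toℕ ri) (toℕ rj))) i+j+1≡4l)
    ri+rj≡3 : toℕ ri + toℕ rj ≡ 3
    ri+rj≡3 = suc-injective (proj₁ quotients)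
    1+qi+qj≡l : suc (qi + qj) ≡ l
    1+qi+qj≡l = proj₂ quotients

  -- t n sits both at 4n and at 4n+3, the outer letters of φ (t n).
  desubstitute-mirror : ∀ {M L} → PalindromeAt M L → ∀ {X} i j u v →
    suc (u + v) ≡ L → M + u ≡ 4 * (X + i) + 3 → M + v ≡ 4 * (X + j) → t (X + i) ≡ t (X + j)
  desubstitute-mirror pal {X} i j u v u+v+1≡L Mu≡ Mv≡ = begin
    t (X + i)             ≡⟨ sym (t-4n+3 (X + i)) ⟩
    t (4 * (X + i) + 3)   ≡⟨ palindromeAt-mirror pal u v u+v+1≡L Mu≡ Mv≡ ⟩
    t (4 * (X + j))       ≡⟨ t-4n (X + j) ⟩
    t (X + j)             ∎
    where open ≡-Reasoning

  desubst-4m : ∀ m l → PalindromeAt (4 * m) (4 * l) → PalindromeAt m l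
  desubst-4m m l pal i j i+j+1≡l =
    desubstitute-mirror pal i j (4 * i + 3) (4 * j) (trans (length≡ i j) (cong (4 *_) i+j+1≡l)) (u≡ m i) (v≡ m j)
    where
    length≡ : ∀ i j → suc (4 * i + 3 + 4 * j) ≡ 4 * suc (i + j)
    length≡ = solve-∀
    u≡ : ∀ m i → 4 * m + (4 * i + 3) ≡ 4 * (m + i) + 3
    u≡ = solve-∀
    v≡ : ∀ m j → 4 * m + 4 * j ≡ 4 * (m + j)
    v≡ = solve-∀

  desubst-4m+1 : ∀ m l → PalindromeAt (4 * m + 1) (4 * l + 2) → PalindromeAt m (suc l)
  desubst-4m+1 m l pal = palindromeAt-fromPositive λ i j i+j+2≡l+1 →
    desubstitute-mirror pal i (suc j) (4 * i + 2) (4 * j + 3)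
      (trans (length≡ i j) (cong (λ l → 4 * l + 2) (suc-injective i+j+2≡l+1))) (u≡ m i) (v≡ m j)
    where
    length≡ : ∀ i j → suc (4 * i + 2 + (4 * j + 3)) ≡ 4 * (i + suc j) + 2
    length≡ = solve-∀
    u≡ : ∀ m i → 4 * m + 1 + (4 * i + 2) ≡ 4 * (m + i) + 3
    u≡ = solve-∀
    v≡ : ∀ m j → 4 * m + 1 + (4 * j + 3) ≡ 4 * (m + suc j)
    v≡ = solve-∀

  desubst-4m+2 : ∀ m l → PalindromeAt (4 * m + 2) (4 * l) → PalindromeAt m (suc l)
  desubst-4m+2 m l pal = palindromeAt-fromPositive λ i j i+j+2≡l+1 →
    desubstitute-mirror pal i (suc j) (4 * i + 1) (4 * j + 2)
      (trans (length≡ i j) (cong (4 *_) (suc-injective i+j+2≡l+1))) (u≡ m i) (v≡ m j)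
    where
    length≡ : ∀ i j → suc (4 * i + 1 + (4 * j + 2)) ≡ 4 * (i + suc j)
    length≡ = solve-∀
    u≡ : ∀ m i → 4 * m + 2 + (4 * i + 1) ≡ 4 * (m + i) + 3
    u≡ = solve-∀
    v≡ : ∀ m j → 4 * m + 2 + (4 * j + 2) ≡ 4 * (m + suc j)
    v≡ = solve-∀

  desubst-4m+3 : ∀ m l → PalindromeAt (4 * m + 3) (4 * l + 2) → PalindromeAt m (2 + l)
  desubst-4m+3 m l pal = palindromeAt-fromPositive λ i j i+j+2≡l+2 →
    desubstitute-mirror pal i (suc j) (4 * i) (4 * j + 1)
      (trans (length≡ i j) (cong (λ l → 4 * l + 2) (suc-injective (trans (sym (+-suc i j)) (suc-injective i+j+2≡l+2)))))
      (u≡ m i) (v≡ m j)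
    where
    length≡ : ∀ i j → suc (4 * i + (4 * j + 1)) ≡ 4 * (i + j) + 2
    length≡ = solve-∀
    u≡ : ∀ m i → 4 * m + 3 + 4 * i ≡ 4 * (m + i) + 3
    u≡ = solve-∀
    v≡ : ∀ m j → 4 * m + 3 + (4 * j + 1) ≡ 4 * (m + suc j)
    v≡ = solve-∀

  PalindromeStep : ℕ → Set
  PalindromeStep N = ∀ M L → M + L ≡ N → PalindromeAt M L → ppl N ≤ suc (ppl M)

  palindromeStep-length3 : ∀ M → PalindromeAt M 3 → ppl (M + 3) ≤ suc (ppl M)
  palindromeStep-length3 M pal with mod4 M
  ... | 4q+0 k = ⊥-elim (x≢complement-x (t k) (begin
    t k                 ≡⟨ sym (t-4n k) ⟩
    t (4 * k)           ≡⟨ palindromeAt-mirror pal 0 2 refl (+-identityʳ (4 * k)) refl ⟩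
    t (4 * k + 2)       ≡⟨ t-4n+2 k ⟩
    complement (t k)    ∎))
    where open ≡-Reasoning
  ... | 4q+1 k = ⊥-elim (x≢complement-x (t k) (begin
    t k                 ≡⟨ sym (t-4n+3 k) ⟩
    t (4 * k + 3)       ≡⟨ palindromeAt-mirror pal 2 0 refl (4k+1+2≡4k+3 k) (+-identityʳ (4 * k + 1)) ⟩
    t (4 * k + 1)       ≡⟨ t-4n+1 k ⟩
    complement (t k)    ∎))
    where
    open ≡-Reasoning
    4k+1+2≡4k+3 : ∀ k → 4 * k + 1 + 2 ≡ 4 * k + 3
    4k+1+2≡4k+3 = solve-∀
  ... | 4q+2 k = begin
    ppl (4 * k + 2 + 3)              ≡⟨ cong ppl (4k+2+3≡4k+5 k) ⟩
    ppl (4 * suc k + 1)              ≡⟨ ppl-4n+1 (suc k) ⟩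
    suc (ppl (suc k))                ≤⟨ s≤s (⊓-glb (≤-trans (ppl-suc-≤ k) (n≤1+n _)) (m≤n+m _ 2)) ⟩
    suc (2 + ppl k ⊓ ppl (suc k))    ≡⟨ cong suc (sym (ppl-4n+2 k)) ⟩
    suc (ppl (4 * k + 2))            ∎
    where
    open ≤-Reasoning
    4k+2+3≡4k+5 : ∀ k → 4 * k + 2 + 3 ≡ 4 * suc k + 1
    4k+2+3≡4k+5 = solve-∀
  ... | 4q+3 k = begin
    ppl (4 * k + 3 + 3)                        ≡⟨ cong ppl (4k+3+3≡4k+6 k) ⟩
    ppl (4 * suc k + 2)                        ≡⟨ ppl-4n+2 (suc k) ⟩
    2 + ppl (suc k) ⊓ ppl (suc (suc k))        ≤⟨ s≤s (s≤s (m⊓n≤m _ _)) ⟩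
    2 + ppl (suc k)                            ≡⟨ cong suc (sym (ppl-4n+3 k)) ⟩
    suc (ppl (4 * k + 3))                      ∎
    where
    open ≤-Reasoning
    4k+3+3≡4k+6 : ∀ k → 4 * k + 3 + 3 ≡ 4 * suc k + 2
    4k+3+3≡4k+6 = solve-∀

  palindromeStep-4m : ∀ m l → <-Rec PalindromeStep (4 * m + 4 * suc l) →
    PalindromeAt (4 * m) (4 * suc l) → ppl (4 * m + 4 * suc l) ≤ suc (ppl (4 * m))
  palindromeStep-4m m l rec pal = begin
    ppl (4 * m + 4 * suc l)   ≡⟨ cong ppl (end≡ m l) ⟩
    ppl (4 * (m + suc l))     ≡⟨ ppl-4n (m + suc l) ⟩
    ppl (m + suc l)           ≤⟨ rec (m+1+k≡n⇒m<n _ (3 * m + 3 * l + 2) (smaller m l))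
                                     m (suc l) refl (desubst-4m m (suc l) pal) ⟩
    suc (ppl m)               ≡⟨ cong suc (sym (ppl-4n m)) ⟩
    suc (ppl (4 * m))         ∎
    where
    open ≤-Reasoning
    end≡ : ∀ m l → 4 * m + 4 * suc l ≡ 4 * (m + suc l)
    end≡ = solve-∀
    smaller : ∀ m l → m + suc l + suc (3 * m + 3 * l + 2) ≡ 4 * m + 4 * suc l
    smaller = solve-∀

  palindromeStep-4m+1 : ∀ m l → <-Rec PalindromeStep (4 * m + 1 + (4 * l + 2)) →
    PalindromeAt (4 * m + 1) (4 * l + 2) → ppl (4 * m + 1 + (4 * l + 2)) ≤ suc (ppl (4 * m + 1))
  palindromeStep-4m+1 m l rec pal = begin
    ppl (4 * m + 1 + (4 * l + 2))   ≡⟨ cong ppl (end≡ m l) ⟩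
    ppl (4 * (m + l) + 3)           ≡⟨ ppl-4n+3 (m + l) ⟩
    suc (ppl (suc (m + l)))         ≡⟨ cong (suc ∘ ppl) (sym (+-suc m l)) ⟩
    suc (ppl (m + suc l))           ≤⟨ s≤s (rec (m+1+k≡n⇒m<n _ (3 * m + 3 * l + 1) (smaller m l))
                                               m (suc l) refl (desubst-4m+1 m l pal)) ⟩
    suc (suc (ppl m))               ≡⟨ cong suc (sym (ppl-4n+1 m)) ⟩
    suc (ppl (4 * m + 1))           ∎
    where
    open ≤-Reasoning
    end≡ : ∀ m l → 4 * m + 1 + (4 * l + 2) ≡ 4 * (m + l) + 3
    end≡ = solve-∀
    smaller : ∀ m l → m + suc l + suc (3 * m + 3 * l + 1) ≡ 4 * m + 1 + (4 * l + 2)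
    smaller = solve-∀

  palindromeStep-4m+2 : ∀ m l → <-Rec PalindromeStep (4 * m + 2 + 4 * suc l) →
    PalindromeAt (4 * m + 2) (4 * suc l) → ppl (4 * m + 2 + 4 * suc l) ≤ suc (ppl (4 * m + 2))
  palindromeStep-4m+2 m l rec pal = begin
    ppl (4 * m + 2 + 4 * suc l)                    ≡⟨ cong ppl (end≡ m l) ⟩
    ppl (4 * suc (m + l) + 2)                      ≡⟨ ppl-4n+2 (suc (m + l)) ⟩
    2 + ppl (suc (m + l)) ⊓ ppl (2 + (m + l))      ≤⟨ s≤s (s≤s (⊓-mono-≤ inner-bound whole-bound)) ⟩
    2 + suc (ppl (suc m)) ⊓ suc (ppl m)            ≡⟨ cong (2 +_) (⊓-comm (suc (ppl (suc m))) (suc (ppl m))) ⟩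
    2 + suc (ppl m) ⊓ suc (ppl (suc m))            ≡⟨ cong suc (sym (ppl-4n+2 m)) ⟩
    suc (ppl (4 * m + 2))                          ∎
    where
    open ≤-Reasoning
    end≡ : ∀ m l → 4 * m + 2 + 4 * suc l ≡ 4 * suc (m + l) + 2
    end≡ = solve-∀
    smaller : ∀ m l → m + (2 + l) + suc (3 * m + 3 * l + 3) ≡ 4 * m + 2 + 4 * suc l
    smaller = solve-∀
    smaller′ : ∀ m l → suc m + l + suc (3 * m + 3 * l + 4) ≡ 4 * m + 2 + 4 * suc l
    smaller′ = solve-∀
    pal′ : PalindromeAt m (2 + l)
    pal′ = desubst-4m+2 m (suc l) pal
    whole-bound : ppl (2 + (m + l)) ≤ suc (ppl m)
    whole-bound = subst (λ n → ppl n ≤ suc (ppl m)) (trans (+-suc m (suc l)) (cong suc (+-suc m l)))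
      (rec (m+1+k≡n⇒m<n _ _ (smaller m l)) m (2 + l) refl pal′)
    inner-bound : ppl (suc (m + l)) ≤ suc (ppl (suc m))
    inner-bound = rec (m+1+k≡n⇒m<n _ _ (smaller′ m l)) (suc m) l refl (palindromeAt-shrink pal′)

  palindromeStep-4m+3 : ∀ m l → <-Rec PalindromeStep (4 * m + 3 + (4 * l + 2)) →
    PalindromeAt (4 * m + 3) (4 * l + 2) → ppl (4 * m + 3 + (4 * l + 2)) ≤ suc (ppl (4 * m + 3))
  palindromeStep-4m+3 m l rec pal = begin
    ppl (4 * m + 3 + (4 * l + 2))   ≡⟨ cong ppl (end≡ m l) ⟩
    ppl (4 * suc (m + l) + 1)       ≡⟨ ppl-4n+1 (suc (m + l)) ⟩
    suc (ppl (suc m + l))           ≤⟨ s≤s (rec (m+1+k≡n⇒m<n _ (3 * m + 3 * l + 3) (smaller m l))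
                                               (suc m) l refl (palindromeAt-shrink (desubst-4m+3 m l pal))) ⟩
    suc (suc (ppl (suc m)))         ≡⟨ cong suc (sym (ppl-4n+3 m)) ⟩
    suc (ppl (4 * m + 3))           ∎
    where
    open ≤-Reasoning
    end≡ : ∀ m l → 4 * m + 3 + (4 * l + 2) ≡ 4 * suc (m + l) + 1
    end≡ = solve-∀
    smaller : ∀ m l → suc m + l + suc (3 * m + 3 * l + 3) ≡ 4 * m + 3 + (4 * l + 2)
    smaller = solve-∀

  palindromeStep : ∀ N → <-Rec PalindromeStep N → PalindromeStep N
  palindromeStep _ rec M L refl pal with mod4 L
  ... | 4q+0 zero    = subst (λ n → ppl n ≤ suc (ppl M)) (sym (+-identityʳ M)) (n≤1+n (ppl M))
  ... | 4q+1 zero    = subst (λ n → ppl n ≤ suc (ppl M)) (+-comm 1 M) (ppl-suc-≤ M)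
  ... | 4q+3 zero    = palindromeStep-length3 M pal
  ... | 4q+1 (suc l) = ⊥-elim (¬palindromeAt-odd≥5 (l + l) (odd≡ l) pal)
    where
    odd≡ : ∀ l → l + l + 5 + (l + l) ≡ 4 * suc l + 1
    odd≡ = solve-∀
  ... | 4q+3 (suc l) = ⊥-elim (¬palindromeAt-odd≥5 (suc (l + l)) (odd≡ l) pal)
    where
    odd≡ : ∀ l → suc (l + l) + 5 + suc (l + l) ≡ 4 * suc l + 3
    odd≡ = solve-∀
  ... | 4q+0 (suc l) with mod4 M
  ...   | 4q+0 m = palindromeStep-4m m l rec pal
  ...   | 4q+2 m = palindromeStep-4m+2 m l rec pal
  ...   | 4q+1 m = ⊥-elim (¬palindromeAt-evenCentre (suc (l + l)) (suc (m + m + l)) (even≡ l) (centre≡ m l) pal)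
    where
    centre≡ : ∀ m l → 4 * m + 1 + suc (l + l) ≡ suc (m + m + l) + suc (m + m + l)
    centre≡ = solve-∀
    even≡ : ∀ l → 2 + (l + l) + (2 + (l + l)) ≡ 4 * suc l
    even≡ = solve-∀
  ...   | 4q+3 m = ⊥-elim (¬palindromeAt-evenCentre (suc (l + l)) (2 + (m + m + l)) (even≡ l) (centre≡ m l) pal)
    where
    centre≡ : ∀ m l → 4 * m + 3 + suc (l + l) ≡ 2 + (m + m + l) + (2 + (m + m + l))
    centre≡ = solve-∀
    even≡ : ∀ l → 2 + (l + l) + (2 + (l + l)) ≡ 4 * suc l
    even≡ = solve-∀
  palindromeStep _ rec M L refl pal | 4q+2 l with mod4 M
  ...   | 4q+1 m = palindromeStep-4m+1 m l rec pal
  ...   | 4q+3 m = palindromeStep-4m+3 m l rec pal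
  ...   | 4q+0 m = ⊥-elim (¬palindromeAt-evenCentre (l + l) (m + m + l) (even≡ l) (centre≡ m l) pal)
    where
    centre≡ : ∀ m l → 4 * m + (l + l) ≡ m + m + l + (m + m + l)
    centre≡ = solve-∀
    even≡ : ∀ l → suc (l + l) + suc (l + l) ≡ 4 * l + 2
    even≡ = solve-∀
  ...   | 4q+2 m = ⊥-elim (¬palindromeAt-evenCentre (l + l) (suc (m + m + l)) (even≡ l) (centre≡ m l) pal)
    where
    centre≡ : ∀ m l → 4 * m + 2 + (l + l) ≡ suc (m + m + l) + suc (m + m + l)
    centre≡ = solve-∀
    even≡ : ∀ l → suc (l + l) + suc (l + l) ≡ 4 * l + 2
    even≡ = solve-∀

  ppl-palindrome : ∀ M L → PalindromeAt M L → ppl (M + L) ≤ suc (ppl M)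
  ppl-palindrome M L = <-rec PalindromeStep palindromeStep (M + L) M L refl

  infixl 5 _▷_ _▷letter

  -- The index suc (M + L), rather than M + suc L, lets one match on a factorization of a
  -- nonempty prefix.
  data Factorization : ℕ → ℕ → Set where
    []  : Factorization 0 0
    _▷_ : ∀ {M k L} → Factorization M k → PalindromeAt M (suc L) → Factorization (suc (M + L)) (suc k)

  castFactorization : ∀ {N N′ k} → N ≡ N′ → Factorization N k → Factorization N′ k
  castFactorization refl f = f

  _▷letter : ∀ {N k} → Factorization N k → Factorization (N + 1) (suc k)
  _▷letter {N} f = castFactorization (trans (cong suc (+-identityʳ N)) (+-comm 1 N)) (f ▷ palindromeAt-1 N)

  factorization-φ : ∀ {N k} → Factorization N k → Factorization (4 * N) k
  factorization-φ []                    = []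
  factorization-φ (_▷_ {M} {L = L} f pal) =
    castFactorization (end≡ M L)
      (factorization-φ f ▷ subst (PalindromeAt (4 * M)) (length≡ L) (palindromeAt-φ pal))
    where
    end≡ : ∀ M L → suc (4 * M + (4 * L + 3)) ≡ 4 * suc (M + L)
    end≡ = solve-∀
    length≡ : ∀ L → 4 * suc L ≡ suc (4 * L + 3)
    length≡ = solve-∀

  -- Apply φ, then strip the outer letters of the image of the last block
  -- and make the first of them a block of its own.
  factorization-4n+3 : ∀ {n k} → Factorization (suc n) k → Factorization (4 * n + 3) (suc k)
  factorization-4n+3 (_▷_ {M} {L = L} f pal) =
    castFactorization (end≡ M L)
      (factorization-φ f ▷letter ▷ inner)
    where
    end≡ : ∀ M L → suc (4 * M + 1 + (4 * L + 1)) ≡ 4 * (M + L) + 3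
    end≡ = solve-∀
    length≡ : ∀ L → 4 * suc L ≡ 2 + suc (4 * L + 1)
    length≡ = solve-∀
    inner : PalindromeAt (4 * M + 1) (suc (4 * L + 1))
    inner = subst (λ M′ → PalindromeAt M′ (suc (4 * L + 1))) (+-comm 1 (4 * M))
      (palindromeAt-shrink (subst (PalindromeAt (4 * M)) (length≡ L) (palindromeAt-φ pal)))

  factorization-4n+2 : ∀ {n k} → Factorization (suc n) k → ∃ λ k′ → k′ ≤ 2 + k × Factorization (4 * n + 2) k′
  factorization-4n+2 (_▷_ {M} {L = zero} f pal) =
    _ , n≤1+n _ , castFactorization (end≡ M) (factorization-φ f ▷letter ▷letter)
    where
    end≡ : ∀ M → 4 * M + 1 + 1 ≡ 4 * (M + 0) + 2
    end≡ = solve-∀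
  factorization-4n+2 (_▷_ {M} {L = suc L} f pal) =
    _ , ≤-refl ,
    castFactorization (end≡ M L)
      (factorization-φ f ▷letter ▷letter ▷ inner)
    where
    end≡ : ∀ M L → suc (4 * M + 1 + 1 + (4 * L + 3)) ≡ 4 * (M + suc L) + 2
    end≡ = solve-∀
    start≡ : ∀ M → 2 + 4 * M ≡ 4 * M + 1 + 1
    start≡ = solve-∀
    length≡ : ∀ L → 4 * suc (suc L) ≡ 2 + (2 + suc (4 * L + 3))
    length≡ = solve-∀
    inner : PalindromeAt (4 * M + 1 + 1) (suc (4 * L + 3))
    inner = subst (λ M′ → PalindromeAt M′ (suc (4 * L + 3))) (start≡ M)
      (palindromeAt-shrink (palindromeAt-shrink (subst (PalindromeAt (4 * M)) (length≡ L) (palindromeAt-φ pal))))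

  ShortFactorization : ℕ → Set
  ShortFactorization n = ∃ λ k → k ≤ ppl n × Factorization n k

  shortFactorization-4n : ∀ {n} → ShortFactorization n → ShortFactorization (4 * n)
  shortFactorization-4n {n} (k , k≤ppl , f) =
    k , subst (k ≤_) (sym (ppl-4n n)) k≤ppl , factorization-φ f

  shortFactorization-4n+1 : ∀ {n} → ShortFactorization n → ShortFactorization (4 * n + 1)
  shortFactorization-4n+1 {n} (k , k≤ppl , f) =
    suc k , subst (suc k ≤_) (sym (ppl-4n+1 n)) (s≤s k≤ppl) , factorization-φ f ▷letter

  shortFactorization-4n+2 : ∀ {n} → ShortFactorization n → ShortFactorization (suc n) →
    ShortFactorization (4 * n + 2)
  shortFactorization-4n+2 {n} (k , k≤ppl , f) (k′ , k′≤ppl , f′) with ≤-total (ppl n) (ppl (suc n))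
  ... | inj₁ ppl≤ = 2 + k , subst (2 + k ≤_) (sym ppl≡) (s≤s (s≤s k≤ppl)) ,
                    castFactorization (4n+1+1≡4n+2 n) (factorization-φ f ▷letter ▷letter)
    where
    ppl≡ : ppl (4 * n + 2) ≡ 2 + ppl n
    ppl≡ = trans (ppl-4n+2 n) (cong (2 +_) (m≤n⇒m⊓n≡m ppl≤))
    4n+1+1≡4n+2 : ∀ n → 4 * n + 1 + 1 ≡ 4 * n + 2
    4n+1+1≡4n+2 = solve-∀
  ... | inj₂ ppl≥ = let k″ , k″≤ , f″ = factorization-4n+2 f′ in
                    k″ , subst (k″ ≤_) (sym ppl≡) (≤-trans k″≤ (s≤s (s≤s k′≤ppl))) , f″
    where
    ppl≡ : ppl (4 * n + 2) ≡ 2 + ppl (suc n)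
    ppl≡ = trans (ppl-4n+2 n) (cong (2 +_) (m≥n⇒m⊓n≡n ppl≥))

  shortFactorization-4n+3 : ∀ {n} → ShortFactorization (suc n) → ShortFactorization (4 * n + 3)
  shortFactorization-4n+3 {n} (k , k≤ppl , f) =
    suc k , subst (suc k ≤_) (sym (ppl-4n+3 n)) (s≤s k≤ppl) , factorization-4n+3 f

  shortFactorization : ∀ n → ShortFactorization n
  shortFactorization = <-rec ShortFactorization build
    where
    split₁ : ∀ q → q + suc (3 * q) ≡ 4 * q + 1
    split₁ = solve-∀
    split₂ : ∀ q → q + suc (3 * q + 1) ≡ 4 * q + 2
    split₂ = solve-∀
    split₂′ : ∀ q → suc q + suc (3 * q) ≡ 4 * q + 2
    split₂′ = solve-∀
    split₃ : ∀ q → suc q + suc (3 * q + 1) ≡ 4 * q + 3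
    split₃ = solve-∀
    build : ∀ n → <-Rec ShortFactorization n → ShortFactorization n
    build n rec with mod4 n
    ... | 4q+0 zero    = 0 , z≤n , []
    ... | 4q+0 (suc q) = shortFactorization-4n (rec (m<m+n (suc q) z<s))
    ... | 4q+1 q       = shortFactorization-4n+1 (rec (m+1+k≡n⇒m<n q _ (split₁ q)))
    ... | 4q+2 q       = shortFactorization-4n+2 (rec (m+1+k≡n⇒m<n q _ (split₂ q)))
                                                  (rec (m+1+k≡n⇒m<n (suc q) _ (split₂′ q)))
    ... | 4q+3 q       = shortFactorization-4n+3 (rec (m+1+k≡n⇒m<n (suc q) _ (split₃ q)))

  segment : ℕ → ℕ → List Letter
  segment M L = applyUpTo (λ i → t (M + i)) L

  palindromeAt⇒palindrome : ∀ M L → PalindromeAt M L → Palindrome (segment M L)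
  palindromeAt⇒palindrome M L pal =
    trans (reverse-applyUpTo′ _ L) (applyUpTo-cong L λ i i<L → pal (L ∸ suc i) i (mirror-index i<L))
    where
    mirror-index : ∀ {i} → i < L → suc (L ∸ suc i + i) ≡ L
    mirror-index {i} i<L = trans (sym (+-suc (L ∸ suc i) i)) (m∸n+n≡m i<L)

  palindrome⇒palindromeAt : ∀ M L → Palindrome (segment M L) → PalindromeAt M L
  palindrome⇒palindromeAt M L pal i j i+j+1≡L =
    trans (cong (λ k → t (M + k)) (sym L∸1+j≡i))
      (applyUpTo-injective L (trans (sym (reverse-applyUpTo′ _ L)) pal) j j<L)
    where
    L∸1+j≡i : L ∸ suc j ≡ i
    L∸1+j≡i = trans (cong (_∸ suc j) (sym i+j+1≡L)) (m+n∸n≡m i j)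
    j<L : j < L
    j<L = subst (j <_) i+j+1≡L (s≤s (m≤n+m j i))

  ppl-≤-length : ∀ ws M L → All Palindrome ws → concat ws ≡ segment M L → ppl (M + L) ≤ ppl M + length ws
  ppl-≤-length []       M zero [] refl = ≤-reflexive (trans (cong ppl (+-identityʳ M)) (sym (+-identityʳ (ppl M))))
  ppl-≤-length (w ∷ ws) M L (pw ∷ pws) eq with ++-≡-applyUpTo _ w (concat ws) L eq
  ... | L₁ , L₂ , L₁+L₂≡L , w≡ , ws≡ = begin
    ppl (M + L)                ≡⟨ cong ppl (trans (cong (M +_) (sym L₁+L₂≡L)) (sym (+-assoc M L₁ L₂))) ⟩
    ppl (M + L₁ + L₂)          ≤⟨ ppl-≤-length ws (M + L₁) L₂ pws
                                    (trans ws≡ (applyUpTo-cong L₂ λ i _ → cong t (sym (+-assoc M L₁ i)))) ⟩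
    ppl (M + L₁) + length ws   ≤⟨ +-monoˡ-≤ (length ws)
                                    (ppl-palindrome M L₁ (palindrome⇒palindromeAt M L₁ (subst Palindrome w≡ pw))) ⟩
    suc (ppl M) + length ws    ≡⟨ sym (+-suc (ppl M) (length ws)) ⟩
    ppl M + length (w ∷ ws)    ∎
    where open ≤-Reasoning

  toPalFactorization : ∀ {N k} → Factorization N k → PalFactorization (applyUpTo t N) k
  toPalFactorization [] = [] , [] , refl , refl
  toPalFactorization (_▷_ {M} {k} {L} f pal) =
    let ws , pws , concat≡ , length≡ = toPalFactorization f in
    ws ++ [ segment M (suc L) ] ,
    ++⁺ pws (palindromeAt⇒palindrome M (suc L) pal ∷ []) ,
    (begin
      concat (ws ++ [ segment M (suc L) ])          ≡⟨ sym (concat-++ ws [ segment M (suc L) ]) ⟩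
      concat ws ++ (segment M (suc L) ++ [])        ≡⟨ cong₂ _++_ concat≡ (++-identityʳ (segment M (suc L))) ⟩
      applyUpTo t M ++ segment M (suc L)            ≡⟨ sym (applyUpTo-+ t M (suc L)) ⟩
      applyUpTo t (M + suc L)                       ≡⟨ cong (applyUpTo t) (+-suc M L) ⟩
      applyUpTo t (suc (M + L))                     ∎) ,
    trans (length-++ ws) (trans (cong (_+ 1) length≡) (+-comm k 1))
    where open ≡-Reasoning

  PPL≡ppl : ∀ {PPL : ℕ → ℕ} → (∀ n → IsPalLength (prefix t n) (PPL n)) → ∀ n → PPL n ≡ ppl n
  PPL≡ppl {PPL} isPPL n = ≤-antisym PPL≤ppl ppl≤PPL
    where
    PPL≤ppl : PPL n ≤ ppl n
    PPL≤ppl =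
      let k , k≤ppl , f = shortFactorization n
          ws , pws , concat≡ , length≡ = toPalFactorization f
      in ≤-trans (proj₂ (isPPL n) k (ws , pws , trans concat≡ (sym (map-upTo t n)) , length≡)) k≤ppl
    ppl≤PPL : ppl n ≤ PPL n
    ppl≤PPL =
      let ws , pws , concat≡ , length≡ = proj₁ (isPPL n)
      in subst (ppl n ≤_) length≡ (ppl-≤-length ws 0 n pws (trans concat≡ (map-upTo t n)))

-- Growth of ppl

pplSum : ℕ → ℕ
pplSum n = uncurry _+_ (pplPair n)

step-sum : ∀ r {p} → AtMostOneApart p → uncurry _+_ (step r p) ≤ 3 + uncurry _+_ p
step-sum 0F {x , y} (x≤1+y , _) = begin
  x + suc x           ≤⟨ +-monoʳ-≤ x (s≤s (≤-trans x≤1+y (n≤1+n _))) ⟩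
  x + (3 + y)         ≡⟨ +-suc x (2 + y) ⟩
  suc (x + (2 + y))   ≡⟨ cong suc (+-suc x (suc y)) ⟩
  2 + (x + suc y)     ≡⟨ cong (2 +_) (+-suc x y) ⟩
  3 + (x + y)         ∎
  where open ≤-Reasoning
step-sum 1F {x , y} _ = begin
  suc x + (2 + x ⊓ y)   ≤⟨ +-monoʳ-≤ (suc x) (s≤s (s≤s (m⊓n≤n x y))) ⟩
  suc x + (2 + y)       ≡⟨ cong suc (+-suc x (suc y)) ⟩
  2 + (x + suc y)       ≡⟨ cong (2 +_) (+-suc x y) ⟩
  3 + (x + y)           ∎
  where open ≤-Reasoning
step-sum 2F {x , y} _ = begin
  2 + x ⊓ y + suc y     ≤⟨ +-monoˡ-≤ (suc y) (s≤s (s≤s (m⊓n≤m x y))) ⟩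
  2 + x + suc y         ≡⟨ cong (2 +_) (+-suc x y) ⟩
  3 + (x + y)           ∎
  where open ≤-Reasoning
step-sum 3F {x , y} (_ , y≤1+x) = +-monoˡ-≤ y (s≤s (≤-trans y≤1+x (n≤1+n _)))

pplSum-digit : ∀ q (r : Fin 4) → pplSum (4 * q + toℕ r) ≤ 3 + pplSum q
pplSum-digit q r = subst (λ p → uncurry _+_ p ≤ 3 + pplSum q) (sym (pplPair-digit q r))
  (step-sum r (pplPair-atMostOneApart q))

2^2pplSum≤256n³ : ∀ n → 1 ≤ n → 2 ^ (2 * pplSum n) ≤ 256 * n ^ 3
2^2pplSum≤256n³ = <-rec (λ n → 1 ≤ n → 2 ^ (2 * pplSum n) ≤ 256 * n ^ 3) bound
  where
  swap : ∀ x → 64 * (256 * x) ≡ 256 * (64 * x)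
  swap = solve-∀
  bound : ∀ n → <-Rec (λ n → 1 ≤ n → 2 ^ (2 * pplSum n) ≤ 256 * n ^ 3) n → 1 ≤ n → 2 ^ (2 * pplSum n) ≤ 256 * n ^ 3
  bound n rec 1≤n with divMod4 n
  ... | zero , 1F , refl = from-yes (2 ^ (2 * pplSum 1) ≤? 256 * 1 ^ 3)
  ... | zero , 2F , refl = from-yes (2 ^ (2 * pplSum 2) ≤? 256 * 2 ^ 3)
  ... | zero , 3F , refl = from-yes (2 ^ (2 * pplSum 3) ≤? 256 * 3 ^ 3)
  ... | suc q , r , refl = begin
    2 ^ (2 * pplSum (4 * suc q + toℕ r))  ≤⟨ ^-monoʳ-≤ 2 (*-monoʳ-≤ 2 (pplSum-digit (suc q) r)) ⟩
    2 ^ (2 * (3 + pplSum (suc q)))        ≡⟨ cong (2 ^_) (*-distribˡ-+ 2 3 (pplSum (suc q))) ⟩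
    2 ^ (6 + 2 * pplSum (suc q))          ≡⟨ ^-distribˡ-+-* 2 6 (2 * pplSum (suc q)) ⟩
    64 * 2 ^ (2 * pplSum (suc q))         ≤⟨ *-monoʳ-≤ 64 (rec (<-≤-trans (m<m+n (suc q) z<s) (m≤m+n _ (toℕ r))) (s≤s z≤n)) ⟩
    64 * (256 * suc q ^ 3)                ≡⟨ swap (suc q ^ 3) ⟩
    256 * (4 ^ 3 * suc q ^ 3)             ≡⟨ cong (256 *_) (sym (^-distribʳ-* 4 (suc q) 3)) ⟩
    256 * (4 * suc q) ^ 3                 ≤⟨ *-monoʳ-≤ 256 (^-monoˡ-≤ 3 (m≤m+n (4 * suc q) (toℕ r))) ⟩
    256 * (4 * suc q + toℕ r) ^ 3         ∎
    where open ≤-Reasoning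

4ppl≤2pplSum+2 : ∀ n → 4 * ppl n ≤ 2 * pplSum n + 2
4ppl≤2pplSum+2 n = begin
  4 * ppl n                             ≡⟨ split (ppl n) ⟩
  2 * ppl n + 2 * ppl n                 ≤⟨ +-monoʳ-≤ (2 * ppl n) (*-monoʳ-≤ 2 (ppl-≤-suc n)) ⟩
  2 * ppl n + 2 * suc (ppl (suc n))     ≡⟨ regroup (ppl n) (ppl (suc n)) ⟩
  2 * (ppl n + ppl (suc n)) + 2         ≡⟨ cong (λ y → 2 * (ppl n + y) + 2) (ppl-suc n) ⟩
  2 * pplSum n + 2                      ∎
  where
  open ≤-Reasoning
  split : ∀ x → 4 * x ≡ 2 * x + 2 * x
  split = solve-∀
  regroup : ∀ x y → 2 * x + 2 * suc y ≡ 2 * (x + y) + 2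
  regroup = solve-∀

2^4ppl≤1024n³ : ∀ n → 1 ≤ n → 2 ^ (4 * ppl n) ≤ 1024 * n ^ 3
2^4ppl≤1024n³ n 1≤n = begin
  2 ^ (4 * ppl n)            ≤⟨ ^-monoʳ-≤ 2 (4ppl≤2pplSum+2 n) ⟩
  2 ^ (2 * pplSum n + 2)     ≡⟨ ^-distribˡ-+-* 2 (2 * pplSum n) 2 ⟩
  2 ^ (2 * pplSum n) * 4     ≤⟨ *-monoˡ-≤ 4 (2^2pplSum≤256n³ n 1≤n) ⟩
  256 * n ^ 3 * 4            ≡⟨ rescale (n ^ 3) ⟩
  1024 * n ^ 3               ∎
  where
  open ≤-Reasoning
  rescale : ∀ x → 256 * x * 4 ≡ 1024 * x
  rescale = solve-∀

ppl-limsup-≤ : ∀ {f : ℕ → ℕ} → (∀ n → f n ≤ ppl n) →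
  ∀ p q → 3 * q < 4 * p → Σ ℕ λ N → ∀ n → N ≤ n → 2 ^ (q * f n) < n ^ p
ppl-limsup-≤ {f} f≤ppl p q 3q<4p = suc (1024 ^ q) , bound
  where
  shuffle : ∀ q x → q * x * 4 ≡ 4 * x * q
  shuffle = solve-∀
  bound : ∀ n → suc (1024 ^ q) ≤ n → 2 ^ (q * f n) < n ^ p
  bound n@(suc _) 1024^q<n = ^-cancelˡ-< 4 (begin-strict
    (2 ^ (q * f n)) ^ 4        ≤⟨ ^-monoˡ-≤ 4 (^-monoʳ-≤ 2 (*-monoʳ-≤ q (f≤ppl n))) ⟩
    (2 ^ (q * ppl n)) ^ 4      ≡⟨ ^-*-assoc 2 (q * ppl n) 4 ⟩
    2 ^ (q * ppl n * 4)        ≡⟨ cong (2 ^_) (shuffle q (ppl n)) ⟩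
    2 ^ (4 * ppl n * q)        ≡⟨ sym (^-*-assoc 2 (4 * ppl n) q) ⟩
    (2 ^ (4 * ppl n)) ^ q      ≤⟨ ^-monoˡ-≤ q (2^4ppl≤1024n³ n (s≤s z≤n)) ⟩
    (1024 * n ^ 3) ^ q         ≡⟨ ^-distribʳ-* 1024 (n ^ 3) q ⟩
    1024 ^ q * (n ^ 3) ^ q     ≡⟨ cong (1024 ^ q *_) (^-*-assoc n 3 q) ⟩
    1024 ^ q * n ^ (3 * q)     <⟨ *-monoˡ-< (n ^ (3 * q)) {{m^n≢0 n (3 * q)}} 1024^q<n ⟩
    n ^ suc (3 * q)            ≤⟨ ^-monoʳ-≤ n (subst (suc (3 * q) ≤_) (*-comm 4 p) 3q<4p) ⟩
    n ^ (p * 4)                ≡⟨ sym (^-*-assoc n p 4) ⟩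
    (n ^ p) ^ 4                ∎)
    where open ≤-Reasoning

-- Appending the digits 1 and 2 raises ppl by 3 when ppl n = ppl (n + 1).
peak : ℕ → ℕ
peak zero    = 2
peak (suc k) = 4 * (4 * peak k + 1) + 2

pplPair-peak : ∀ k → pplPair (peak k) ≡ (3 * k + 2 , 3 * k + 2)
pplPair-peak zero    = refl
pplPair-peak (suc k) = begin
  pplPair (4 * (4 * peak k + 1) + 2)            ≡⟨ pplPair-digit (4 * peak k + 1) 2F ⟩
  step 2F (pplPair (4 * peak k + 1))            ≡⟨ cong (step 2F) (pplPair-digit (peak k) 1F) ⟩
  step 2F (step 1F (pplPair (peak k)))          ≡⟨ cong (step 2F ∘ step 1F) (pplPair-peak k) ⟩
  step 2F (step 1F (3 * k + 2 , 3 * k + 2))     ≡⟨ two-steps (3 * k + 2) ⟩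
  (3 + (3 * k + 2) , 3 + (3 * k + 2))           ≡⟨ cong (λ x → x , x) (next k) ⟩
  (3 * suc k + 2 , 3 * suc k + 2)               ∎
  where
  open ≡-Reasoning
  two-steps : ∀ c → step 2F (step 1F (c , c)) ≡ (3 + c , 3 + c)
  two-steps c rewrite ⊓-idem c | m≤n⇒m⊓n≡m (n≤1+n c) = refl
  next : ∀ k → 3 + (3 * k + 2) ≡ 3 * suc k + 2
  next = solve-∀

peak<2^4k+2 : ∀ k → peak k < 2 ^ (4 * k + 2)
peak<2^4k+2 zero    = s≤s (s≤s (s≤s z≤n))
peak<2^4k+2 (suc k) = begin-strict
  4 * (4 * peak k + 1) + 2        <⟨ m<m+n _ z<s ⟩
  4 * (4 * peak k + 1) + 2 + 10   ≡⟨ expand (peak k) ⟩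
  16 * suc (peak k)               ≤⟨ *-monoʳ-≤ 16 (peak<2^4k+2 k) ⟩
  16 * 2 ^ (4 * k + 2)            ≡⟨ sym (^-distribˡ-+-* 2 4 (4 * k + 2)) ⟩
  2 ^ (4 + (4 * k + 2))           ≡⟨ cong (2 ^_) (next k) ⟩
  2 ^ (4 * suc k + 2)             ∎
  where
  open ≤-Reasoning
  expand : ∀ x → 4 * (4 * x + 1) + 2 + 10 ≡ 16 * suc x
  expand = solve-∀
  next : ∀ k → 4 + (4 * k + 2) ≡ 4 * suc k + 2
  next = solve-∀

k≤peak : ∀ k → k ≤ peak k
k≤peak zero    = z≤n
k≤peak (suc k) = ≤-trans (s≤s (k≤peak k)) (subst (suc (peak k) ≤_) (sym (expand (peak k))) (m≤m+n _ _))
  where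
  expand : ∀ x → 4 * (4 * x + 1) + 2 ≡ suc x + (15 * x + 5)
  expand = solve-∀

[4k+2]p<q[3k+2] : ∀ k p q → 2 * p ≤ k → 0 < q → 4 * p < 3 * q → (4 * k + 2) * p < q * (3 * k + 2)
[4k+2]p<q[3k+2] k p q 2p≤k 0<q 4p<3q = begin-strict
  (4 * k + 2) * p               ≡⟨ expand₁ k p ⟩
  4 * p * k + 2 * p             <⟨ +-monoʳ-< (4 * p * k) (<-≤-trans (m<m+n (2 * p) (*-monoʳ-< 2 0<q)) (+-monoˡ-≤ (2 * q) 2p≤k)) ⟩
  4 * p * k + (k + 2 * q)       ≡⟨ expand₂ k p q ⟩
  suc (4 * p) * k + 2 * q       ≤⟨ +-monoˡ-≤ (2 * q) (*-monoˡ-≤ k 4p<3q) ⟩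
  3 * q * k + 2 * q             ≡⟨ expand₃ k q ⟩
  q * (3 * k + 2)               ∎
  where
  open ≤-Reasoning
  expand₁ : ∀ k p → (4 * k + 2) * p ≡ 4 * p * k + 2 * p
  expand₁ = solve-∀
  expand₂ : ∀ k p q → 4 * p * k + (k + 2 * q) ≡ suc (4 * p) * k + 2 * q
  expand₂ = solve-∀
  expand₃ : ∀ k q → 3 * q * k + 2 * q ≡ q * (3 * k + 2)
  expand₃ = solve-∀

ppl-limsup-≥ : ∀ {f : ℕ → ℕ} → (∀ n → ppl n ≤ f n) →
  ∀ p q → 0 < q → 4 * p < 3 * q → ∀ N → Σ ℕ λ n → N ≤ n × n ^ p < 2 ^ (q * f n)
ppl-limsup-≥ {f} ppl≤f p q 0<q 4p<3q N = peak k , ≤-trans (m≤m+n N (2 * p)) (k≤peak k) , (begin-strict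
  peak k ^ p                       ≤⟨ ^-monoˡ-≤ p (<⇒≤ (peak<2^4k+2 k)) ⟩
  (2 ^ (4 * k + 2)) ^ p            ≡⟨ ^-*-assoc 2 (4 * k + 2) p ⟩
  2 ^ ((4 * k + 2) * p)            <⟨ ^-monoʳ-< 2 (s≤s (s≤s z≤n)) ([4k+2]p<q[3k+2] k p q (m≤n+m (2 * p) N) 0<q 4p<3q) ⟩
  2 ^ (q * (3 * k + 2))            ≡⟨ cong (λ x → 2 ^ (q * x)) (sym (cong proj₁ (pplPair-peak k))) ⟩
  2 ^ (q * ppl (peak k))           ≤⟨ ^-monoʳ-≤ 2 (*-monoʳ-≤ q (ppl≤f (peak k))) ⟩
  2 ^ (q * f (peak k))             ∎)
  where
  open ≤-Reasoning
  k : ℕ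
  k = N + 2 * p

ppl-4^k : ∀ k → ppl (4 ^ k) ≡ 1
ppl-4^k zero    = refl
ppl-4^k (suc k) = trans (ppl-4n (4 ^ k)) (ppl-4^k k)

ppl-liminf-0 : ∀ {f : ℕ → ℕ} → (∀ n → f n ≤ ppl n) →
  ∀ p q → 0 < q → 0 < p → ∀ N → Σ ℕ λ n → N ≤ n × 2 ^ (q * f n) < n ^ p
ppl-liminf-0 {f} f≤ppl p q@(suc _) _ 0<p N = n , ≤-trans (m≤m+n N q) (n≤4^n (N + q)) , (begin-strict
  2 ^ (q * f n)       ≤⟨ ^-monoʳ-≤ 2 (*-monoʳ-≤ q (f≤ppl n)) ⟩
  2 ^ (q * ppl n)     ≡⟨ cong (λ x → 2 ^ (q * x)) (ppl-4^k (N + q)) ⟩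
  2 ^ (q * 1)         ≡⟨ cong (2 ^_) (*-identityʳ q) ⟩
  2 ^ q               <⟨ ^-monoˡ-< q (s≤s (s≤s (s≤s z≤n))) ⟩
  4 ^ q               ≤⟨ ^-monoʳ-≤ 4 (m≤n+m q N) ⟩
  n                   ≡⟨ sym (^-identityʳ n) ⟩
  n ^ 1               ≤⟨ ^-monoʳ-≤ n {{m^n≢0 4 (N + q)}} 0<p ⟩
  n ^ p               ∎)
  where
  open ≤-Reasoning
  n : ℕ
  n = 4 ^ (N + q)

corollary17 : (t : ℕ → Letter) → t 0 ≡ a → IsFixedPointφ t →
    (PPL : ℕ → ℕ) → ((n : ℕ) → IsPalLength (prefix t n) (PPL n)) →
    ((p q : ℕ) → 0 < q → 3 * q < 4 * p →
      Σ ℕ λ N → (n : ℕ) → N ≤ n → 2 ^ (q * PPL n) < n ^ p)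
    × ((p q : ℕ) → 0 < q → 4 * p < 3 * q →
      (N : ℕ) → Σ ℕ λ n → N ≤ n × n ^ p < 2 ^ (q * PPL n))
    × ((p q : ℕ) → 0 < q → 0 < p →
      (N : ℕ) → Σ ℕ λ n → N ≤ n × 2 ^ (q * PPL n) < n ^ p)
corollary17 t _ fp PPL isPPL =
  (λ p q _ → ppl-limsup-≤ PPL≤ppl p q) , ppl-limsup-≥ ppl≤PPL , ppl-liminf-0 PPL≤ppl
  where
  open FixedPointOfφ t fp using (PPL≡ppl)
  PPL≤ppl : ∀ n → PPL n ≤ ppl n
  PPL≤ppl n = ≤-reflexive (PPL≡ppl isPPL n)
  ppl≤PPL : ∀ n → ppl n ≤ PPL n
  ppl≤PPL n = ≤-reflexive (sym (PPL≡ppl isPPL n))
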